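{- (1) Let $\mathbb{B}$ be an approximant and $X$ a set of jobs with pairwise distinct names such that $\mathrm{fn}(\mathbb{B})\subseteq\mathrm{names}(X)$. Then $\mathbb{B}_X$ is a term (contains no named holes). (2) Consider the EXAM with an arbitrary pool template, and let $s$ be a reachable state. Then $\mathrm{rb}(s)$ is a term.
   Context: Pre-terms $t ::= x\mid\lambda x.t\mid t\,t$; $t\{x:=u\}$ capture-avoiding substitution; a pre-term is well-named if its bound variables are pairwise distinct. Stacks $S ::= \epsilon\mid t:S$. Environments $E ::= \epsilon\mid[x\leftarrow t]:E$; $\mathrm{dom}(E)$, $E(x)$ the pre-term of the (leftmost) entry for $x$. Named multi-contexts $\mathbb{C} ::= x\mid\langle\cdot\rangle_\alpha\mid\lambda x.\mathbb{C}\mid\mathbb{C}\,\mathbb{C}$; $\mathrm{fn}(\mathbb{C})$ its set of names; $\mathbb{C}\{\alpha\leftarrow\mathbb{C}'\}$ capture-allowing replacement of $\langle\cdot\rangle_\alpha$. Approximants $\mathbb{B} ::= \langle\cdot\rangle_\alpha\mid\mathbb{R}\mid\lambda x.\mathbb{B}$, $\mathbb{R} ::= x\mid\mathbb{R}\,\mathbb{B}$. Jobs $(t,S)_\alpha$; $\mathrm{names}(X)$ is the set of names of jobs in $X$. Pool templates provide pools $P$ with $\mathrm{names}(P)$, a support $\mathrm{supp}(P)$ of jobs indexed bijectively by $\mathrm{names}(P)$, $\mathrm{new}(j_\alpha)$ with support $\{j_\alpha\}$, a selection relation $\mathrm{sel}(P,j_\alpha,P')$ with $j_\alpha\in\mathrm{supp}(P)$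 and $\mathrm{supp}(P')=\mathrm{supp}(P)\setminus\{j_\alpha\}$ (some selection existing when the support is nonempty), and $\mathrm{drop}(j_\alpha,P)$, $\mathrm{add}(j_\alpha,P)$ defined for $\alpha\notin\mathrm{names}(P)$ with support $\mathrm{supp}(P)\cup\{j_\alpha\}$; $\mathrm{add}$ extends to lists left to right. EXAM: states $(\mathbb{B},P,E)$; initialization $t\triangleright(\langle\cdot\rangle_\alpha,\mathrm{new}((t',\epsilon)_\alpha),\epsilon)$ with $t'$ a well-named pre-term $\alpha$-equivalent to $t$. Transitions from $(\mathbb{B},P,E)$ after $\mathrm{sel}(P,j_\alpha,P')$: ($\mathtt{sea}_@$) $(t\,u,S)_\alpha\Rightarrow(\mathbb{B},\mathrm{drop}((t,u:S)_\alpha,P'),E)$; ($\beta$) $(\lambda x.t,u:S)_\alpha\Rightarrow(\mathbb{B},\mathrm{drop}((t,S)_\alpha,P'),[x\leftarrow u]:E)$; ($\mathtt{sub}$) $(x,S)_\alpha$ with $x\in\mathrm{dom}(E)\Rightarrow(\mathbb{B},\mathrm{drop}((t',S)_\alpha,P'),E)$, $t'$ a fresh well-named renaming of $E(x)$; ($\mathtt{sea}_\lambda$) $(\lambda x.t,\epsilon)_\alpha\Rightarrow(\mathbb{B}\{\alpha\leftarrow\lambda x.\langle\cdot\rangle_\alpha\},\mathrm{drop}((t,\epsilon)_\alpha,P'),E)$; ($\mathtt{sea}_{\mathcal V}$) $(x,t_1:\dots:t_n)_\alpha$ with $n\ge0$, $x\notin\mathrm{dom}(E)\Rightarrow(\mathbb{B}\{\alpha\leftarrow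 x\,\langle\cdot\rangle_{\beta_1}\cdots\langle\cdot\rangle_{\beta_n}\},\mathrm{add}((t_1,\epsilon)_{\beta_1}:\dots:(t_n,\epsilon)_{\beta_n},P'),E)$, fresh $\beta_i$. Reachable states are those obtained from initial states by finitely many transitions. Read-back: $t\downarrow\epsilon:=t$, $t\downarrow([x\leftarrow u]:E):=(t\{x:=u\})\downarrow E$; stacks pointwise; $\langle t\mid\epsilon\rangle:=t$, $\langle t\mid u:S\rangle:=\langle t\,u\mid S\rangle$; $(t,S)_\alpha\downarrow E:=(t\downarrow E,S\downarrow E)_\alpha$, lifted to sets; $\mathrm{rb}((t,S)_\alpha):=\langle t\mid S\rangle$; $\mathbb{C}_X:=\mathbb{C}\{\alpha_1\leftarrow\mathrm{rb}(j_{\alpha_1})\}\cdots\{\alpha_n\leftarrow\mathrm{rb}(j_{\alpha_n})\}$ for $X=\{j_{\alpha_1},\dots,j_{\alpha_n}\}$ with distinct names; $\mathrm{rb}((\mathbb{B},P,E)):=\mathbb{B}_{\mathrm{supp}(P)\downarrow E}$. -}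

module Defs where

open import Data.Nat using (ℕ; suc; _⊔_; _≟_)
open import Data.Bool using (Bool; true; false; if_then_else_)
open import Data.List using (List; []; _∷_; map; foldr; foldl; concatMap; _++_; zipWith; length)
open import Data.List.Membership.Propositional using (_∈_; _∉_)
open import Data.List.Membership.DecPropositional _≟_ using (_∈?_)
open import Data.List.Relation.Unary.Unique.Propositional using (Unique)
open import Data.Maybe using (Maybe; just; nothing)
open import Data.Product using (_×_; _,_; Σ)
open import Data.Sum using (_⊎_)
open import Relation.Nullary using (does; ¬_)
open import Relation.Binary.PropositionalEquality using (_≡_; _≢_)
open import Function.Bundles using (_⇔_)

data Tm : Set where
  var : ℕ → Tm
  lam : ℕ → Tm → Tm
  app : Tm → Tm → Tm

fv : Tm → List ℕ
fv (var x) = x ∷ []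
fv (lam x t) = removeVar (fv t)
  where
  removeVar : List ℕ → List ℕ
  removeVar [] = []
  removeVar (y ∷ ys) = if does (y ≟ x) then removeVar ys else y ∷ removeVar ys
fv (app t u) = fv t ++ fv u

bv : Tm → List ℕ
bv (var x) = []
bv (lam x t) = x ∷ bv t
bv (app t u) = bv t ++ bv u

vars : Tm → List ℕ
vars (var x) = x ∷ []
vars (lam x t) = x ∷ vars t
vars (app t u) = vars t ++ vars u

WellNamed : Tm → Set
WellNamed t = Unique (bv t)

fresh : List ℕ → ℕ
fresh xs = suc (foldr _⊔_ 0 xs)

-- capture-avoiding simultaneous substitution (Stoughton style)
update : (ℕ → Tm) → ℕ → Tm → (ℕ → Tm)
update σ y u w = if does (w ≟ y) then u else σ w

ssubst : (ℕ → Tm) → Tm → Tm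
ssubst σ (var x) = σ x
ssubst σ (app t u) = app (ssubst σ t) (ssubst σ u)
ssubst σ (lam y t) = lam z (ssubst (update σ y (var z)) t)
  where
  S : List ℕ
  S = concatMap (λ w → fv (σ w)) (fv (lam y t))
  z : ℕ
  z = if does (y ∈? S) then fresh S else y

_[_≔_] : Tm → ℕ → Tm → Tm
t [ x ≔ u ] = ssubst (update var x u) t

VarRel : List (ℕ × ℕ) → ℕ → ℕ → Set
VarRel [] x y = x ≡ y
VarRel ((a , b) ∷ Γ) x y = (x ≡ a × y ≡ b) ⊎ (x ≢ a × y ≢ b × VarRel Γ x y)

data AlphaΓ : List (ℕ × ℕ) → Tm → Tm → Set where
  αvar : ∀ {Γ x y} → VarRel Γ x y → AlphaΓ Γ (var x) (var y)
  αlam : ∀ {Γ x y t u} → AlphaΓ ((x , y) ∷ Γ) t u → AlphaΓ Γ (lam x t) (lam y u)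
  αapp : ∀ {Γ t t' u u'} → AlphaΓ Γ t t' → AlphaΓ Γ u u' → AlphaΓ Γ (app t u) (app t' u')

_≈α_ : Tm → Tm → Set
t ≈α u = AlphaΓ [] t u

data MC : Set where
  mvar : ℕ → MC
  hole : ℕ → MC
  mlam : ℕ → MC → MC
  mapp : MC → MC → MC

⌜_⌝ : Tm → MC
⌜ var x ⌝ = mvar x
⌜ lam x t ⌝ = mlam x ⌜ t ⌝
⌜ app t u ⌝ = mapp ⌜ t ⌝ ⌜ u ⌝

fn : MC → List ℕ
fn (mvar x) = []
fn (hole α) = α ∷ []
fn (mlam x C) = fn C
fn (mapp C D) = fn C ++ fn D

varsMC : MC → List ℕ
varsMC (mvar x) = x ∷ []
varsMC (hole α) = []
varsMC (mlam x C) = x ∷ varsMC C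
varsMC (mapp C D) = varsMC C ++ varsMC D

-- C{α ← C'} (capture-allowing)
replace : MC → ℕ → MC → MC
replace (mvar x) α C' = mvar x
replace (hole β) α C' = if does (β ≟ α) then C' else hole β
replace (mlam x C) α C' = mlam x (replace C α C')
replace (mapp C D) α C' = mapp (replace C α C') (replace D α C')

IsTerm : MC → Set
IsTerm C = fn C ≡ []

mutual
  data IsB : MC → Set where
    bhole : ∀ {α} → IsB (hole α)
    brig  : ∀ {C} → IsR C → IsB C
    blam  : ∀ {x C} → IsB C → IsB (mlam x C)

  data IsR : MC → Set where
    rvar : ∀ {x} → IsR (mvar x)
    rapp : ∀ {C D} → IsR C → IsB D → IsR (mapp C D)

Stack : Set
Stack = List Tm

Env : Set
Env = List (ℕ × Tm)

lookupE : Env → ℕ → Maybe Tm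
lookupE [] x = nothing
lookupE ((y , u) ∷ E) x = if does (x ≟ y) then just u else lookupE E x

record Job : Set where
  constructor job
  field
    tm  : Tm
    stk : Stack
    nm  : ℕ
open Job public

names : List Job → List ℕ
names X = map nm X

varsJob : Job → List ℕ
varsJob (job t S α) = vars t ++ concatMap vars S

varsEnv : Env → List ℕ
varsEnv [] = []
varsEnv ((x , u) ∷ E) = x ∷ vars u ++ varsEnv E

_↓_ : Tm → Env → Tm
t ↓ [] = t
t ↓ ((x , u) ∷ E) = (t [ x ≔ u ]) ↓ E

jobDown : Env → Job → Job
jobDown E (job t S α) = job (t ↓ E) (map (_↓ E) S) α

unstack : Tm → Stack → Tm
unstack t S = foldl app t S

rbJob : Job → MC
rbJob (job t S α) = ⌜ unstack t S ⌝

plug : MC → List Job → MC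
plug C [] = C
plug C (j ∷ X) = plug (replace C (nm j) (rbJob j)) X

record PoolTemplate : Set₁ where
  field
    Pool : Set
    supp : Pool → List Job
    -- support indexed bijectively by names(P)
    supp-unique : ∀ P → Unique (names (supp P))
    new : Job → Pool
    new-supp : ∀ j x → (x ∈ supp (new j)) ⇔ (x ≡ j)
    Sel : Pool → Job → Pool → Set
    sel-in : ∀ {P j P'} → Sel P j P' → j ∈ supp P
    sel-supp : ∀ {P j P'} → Sel P j P' → ∀ x → (x ∈ supp P') ⇔ (x ∈ supp P × x ≢ j)
    sel-exists : ∀ P → supp P ≢ [] → Σ Job λ j → Σ Pool λ P' → Sel P j P'
    -- drop/add: specified only when the name is not in names(P)
    drop : Job → Pool → Pool
    drop-supp : ∀ j P → nm j ∉ names (supp P) → ∀ x → (x ∈ supp (drop j P)) ⇔ (x ∈ supp P ⊎ x ≡ j)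
    add : Job → Pool → Pool
    add-supp : ∀ j P → nm j ∉ names (supp P) → ∀ x → (x ∈ supp (add j P)) ⇔ (x ∈ supp P ⊎ x ≡ j)

module EXAM (T : PoolTemplate) where
  open PoolTemplate T

  addList : List Job → Pool → Pool
  addList [] P = P
  addList (j ∷ js) P = addList js (add j P)

  record State : Set where
    constructor ⟪_,_,_⟫
    field
      ctx  : MC
      pool : Pool
      env  : Env

  stateVars : State → List ℕ
  stateVars ⟪ B , P , E ⟫ = varsMC B ++ concatMap varsJob (supp P) ++ varsEnv E

  appHoles : ℕ → List ℕ → MC
  appHoles x βs = foldl (λ C β → mapp C (hole β)) (mvar x) βs

  data _⇒_ : State → State → Set where
    sea-app : ∀ {B P P' E t u S α} → Sel P (job (app t u) S α) P' →
           ⟪ B , P , E ⟫ ⇒ ⟪ B , drop (job t (u ∷ S) α) P' , E ⟫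
    beta : ∀ {B P P' E x t u S α} → Sel P (job (lam x t) (u ∷ S) α) P' →
           ⟪ B , P , E ⟫ ⇒ ⟪ B , drop (job t S α) P' , (x , u) ∷ E ⟫
    sub  : ∀ {B P P' E x u t' S α} → Sel P (job (var x) S α) P' →
           lookupE E x ≡ just u →
           t' ≈α u → WellNamed t' →
           (∀ v → v ∈ bv t' → v ∉ stateVars ⟪ B , P , E ⟫) →
           ⟪ B , P , E ⟫ ⇒ ⟪ B , drop (job t' S α) P' , E ⟫
    seaλ : ∀ {B P P' E x t α} → Sel P (job (lam x t) [] α) P' →
           ⟪ B , P , E ⟫ ⇒ ⟪ replace B α (mlam x (hole α)) , drop (job t [] α) P' , E ⟫
    seaV : ∀ {B P P' E x ts α} (βs : List ℕ) → Sel P (job (var x) ts α) P' →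
           lookupE E x ≡ nothing →
           length βs ≡ length ts → Unique βs →
           (∀ β → β ∈ βs → β ∉ fn B × β ∉ names (supp P)) →
           ⟪ B , P , E ⟫ ⇒ ⟪ replace B α (appHoles x βs)
                           , addList (zipWith (λ t β → job t [] β) ts βs) P' , E ⟫

  data Reachable : State → Set where
    init : ∀ (t t' : Tm) (α : ℕ) → t ≈α t' → WellNamed t' →
           Reachable ⟪ hole α , new (job t' [] α) , [] ⟫
    step : ∀ {s s'} → Reachable s → s ⇒ s' → Reachable s'

  rb : State → MC
  rb ⟪ B , P , E ⟫ = plug B (map (jobDown E) (supp P))

-- Plugging a read-back job never creates holes, and replacing the hole α only
-- creates the holes of the plugged context; hence every hole name of C that is
-- also a job name of X disappears in C_X, and C_X is a term as soon as
-- fn C ⊆ names X. For the EXAM this covering property is an invariant of the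
-- transitions: sea_@, β and sub keep the current name α in the pool, sea_λ
-- reuses α, and sea_V replaces α by the fresh names βᵢ of the added jobs.
module Submission where

open import Defs
open import Data.Nat using (ℕ; _≟_; suc)
open import Data.Nat.Properties using (suc-injective)
open import Data.Bool using (true; false)
open import Data.List using (List; []; _∷_; _++_; map; foldl; zipWith; length)
open import Data.List.Properties using (map-∘; ++-assoc; ++-identityʳ)
open import Function using (_∘_)
open import Data.List.Membership.Propositional using (_∈_; _∉_)
open import Data.List.Membership.Propositional.Properties using (∈-map⁺; ∈-map⁻; ∈-++⁺ˡ; ∈-++⁺ʳ; ∈-++⁻)
open import Data.List.Relation.Binary.Subset.Propositional using (_⊆_)
open import Data.List.Relation.Binary.Subset.Propositional.Properties using (⊆[]⇒≡[]; map⁺)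
open import Data.List.Relation.Unary.Any using (here; there)
open import Data.List.Relation.Unary.All using (lookup)
open import Data.List.Relation.Unary.AllPairs using (_∷_)
open import Data.List.Relation.Unary.Unique.Propositional using (Unique)
open import Data.Product as Product using (_×_; _,_; proj₁; proj₂)
open import Data.Sum as Sum using (_⊎_; inj₁; inj₂)
open import Relation.Nullary using (yes; no; does; proof; ofⁿ; contradiction)
open import Relation.Binary.PropositionalEquality using (_≡_; _≢_; refl; sym; cong; subst)
open import Function.Bundles using (Equivalence; _⇔_)

fn-⌜⌝ : ∀ t → fn ⌜ t ⌝ ≡ []
fn-⌜⌝ (var x) = refl
fn-⌜⌝ (lam x t) = fn-⌜⌝ t
fn-⌜⌝ (app t u) rewrite fn-⌜⌝ t | fn-⌜⌝ u = refl

fn-rbJob : ∀ j → fn (rbJob j) ≡ []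
fn-rbJob (job t S α) = fn-⌜⌝ (unstack t S)

fn-replace⁻ : ∀ C α D {γ} → γ ∈ fn (replace C α D) → (γ ∈ fn C × γ ≢ α) ⊎ γ ∈ fn D
fn-replace⁻ (mvar x) α D ()
fn-replace⁻ (hole β) α D p with does (β ≟ α) | proof (β ≟ α)
... | true  | _ = inj₂ p
fn-replace⁻ (hole β) α D (here refl) | false | ofⁿ β≢α = inj₁ (here refl , β≢α)
fn-replace⁻ (mlam x C) α D p = fn-replace⁻ C α D p
fn-replace⁻ (mapp C C') α D p with ∈-++⁻ (fn (replace C α D)) p
... | inj₁ q = Sum.map₁ (Product.map₁ ∈-++⁺ˡ) (fn-replace⁻ C α D q)
... | inj₂ q = Sum.map₁ (Product.map₁ (∈-++⁺ʳ (fn C))) (fn-replace⁻ C' α D q)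

fn-plug⁻ : ∀ C X {γ} → γ ∈ fn (plug C X) → γ ∈ fn C × γ ∉ names X
fn-plug⁻ C [] p = p , λ ()
fn-plug⁻ C (j ∷ X) p with fn-plug⁻ (replace C (nm j) (rbJob j)) X p
... | q , γ∉X with fn-replace⁻ C (nm j) (rbJob j) q
... | inj₁ (γ∈C , γ≢j) = γ∈C , λ { (here γ≡j) → γ≢j γ≡j ; (there γ∈X) → γ∉X γ∈X }
... | inj₂ γ∈j with () ← subst (_ ∈_) (fn-rbJob j) γ∈j

plug-isTerm : ∀ C X → fn C ⊆ names X → IsTerm (plug C X)
plug-isTerm C X C⊆X = ⊆[]⇒≡[] λ p → let γ∈C , γ∉X = fn-plug⁻ C X p in contradiction (C⊆X γ∈C) γ∉X

fn-foldl-holes : ∀ C βs → fn (foldl (λ C β → mapp C (hole β)) C βs) ⊆ fn C ++ βs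
fn-foldl-holes C [] = ∈-++⁺ˡ
fn-foldl-holes C (β ∷ βs) p =
  subst (_ ∈_) (++-assoc (fn C) (β ∷ []) βs) (fn-foldl-holes (mapp C (hole β)) βs p)

unique-map-injective : ∀ {A B : Set} {f : A → B} {xs x y} → Unique (map f xs) →
                       x ∈ xs → y ∈ xs → f x ≡ f y → x ≡ y
unique-map-injective (_ ∷ _) (here refl) (here refl) _ = refl
unique-map-injective {f = f} (fx∉ ∷ _) (here refl) (there y∈) fx≡fy =
  contradiction fx≡fy (lookup fx∉ (∈-map⁺ f y∈))
unique-map-injective {f = f} (fy∉ ∷ _) (there x∈) (here refl) fx≡fy =
  contradiction (sym fx≡fy) (lookup fy∉ (∈-map⁺ f x∈))
unique-map-injective (_ ∷ u) (there x∈) (there y∈) fx≡fy = unique-map-injective u x∈ y∈ fx≡fy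

names-zipWith : ∀ S ts βs → length βs ≡ length ts → names (zipWith (λ t β → job t S β) ts βs) ≡ βs
names-zipWith S [] [] _ = refl
names-zipWith S (t ∷ ts) (β ∷ βs) eq = cong (β ∷_) (names-zipWith S ts βs (suc-injective eq))

names-jobDown : ∀ E X → names (map (jobDown E) X) ≡ names X
names-jobDown E X = sym (map-∘ X)

Extends : ∀ {A : Set} → List A → List A → A → Set
Extends ys xs z = ∀ x → x ∈ ys ⇔ (x ∈ xs ⊎ x ≡ z)

Extends-⊇ : ∀ {A : Set} {ys xs : List A} {z} → Extends ys xs z → z ∷ xs ⊆ ys
Extends-⊇ ext (here refl) = Equivalence.from (ext _) (inj₂ refl)
Extends-⊇ ext (there x∈) = Equivalence.from (ext _) (inj₁ x∈)

Extends-⊆ : ∀ {A : Set} {ys xs : List A} {z} → Extends ys xs z → ys ⊆ z ∷ xs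
Extends-⊆ ext x∈ with Equivalence.to (ext _) x∈
... | inj₁ x∈xs = there x∈xs
... | inj₂ x≡z = here x≡z

module PoolNames (T : PoolTemplate) where
  open PoolTemplate T
  open EXAM T using (addList)

  Names : Pool → List ℕ
  Names P = names (supp P)

  sel-name∉ : ∀ {P j P'} → Sel P j P' → nm j ∉ Names P'
  sel-name∉ {P} {j} s nm[j]∈P' with ∈-map⁻ nm nm[j]∈P'
  ... | x , x∈P' , nm[j]≡nm[x] =
    let x∈P , x≢j = Equivalence.to (sel-supp s x) x∈P'
    in x≢j (unique-map-injective (supp-unique P) x∈P (sel-in s) (sym nm[j]≡nm[x]))

  Names-sel⊆ : ∀ {P j P'} → Sel P j P' → Names P' ⊆ Names P
  Names-sel⊆ s = map⁺ nm λ {x} x∈P' → proj₁ (Equivalence.to (sel-supp s x) x∈P')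

  Names-sel⊆∷ : ∀ {P j P'} → Sel P j P' → Names P ⊆ nm j ∷ Names P'
  Names-sel⊆∷ {j = j} s γ∈P with ∈-map⁻ nm γ∈P
  ... | x , x∈P , refl with nm x ≟ nm j
  ...   | yes nm[x]≡nm[j] = here nm[x]≡nm[j]
  ...   | no nm[x]≢nm[j] =
    there (∈-map⁺ nm (Equivalence.from (sel-supp s x) (x∈P , λ x≡j → nm[x]≢nm[j] (cong nm x≡j))))

  Names-drop⊇ : ∀ j P → nm j ∉ Names P → nm j ∷ Names P ⊆ Names (drop j P)
  Names-drop⊇ j P j-fresh = map⁺ nm (Extends-⊇ (drop-supp j P j-fresh))

  Names-add⊇ : ∀ j P → nm j ∉ Names P → nm j ∷ Names P ⊆ Names (add j P)
  Names-add⊇ j P j-fresh = map⁺ nm (Extends-⊇ (add-supp j P j-fresh))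

  Names-add⊆ : ∀ j P → nm j ∉ Names P → Names (add j P) ⊆ nm j ∷ Names P
  Names-add⊆ j P j-fresh = map⁺ nm (Extends-⊆ (add-supp j P j-fresh))

  Names-addList⊇ : ∀ L P → Unique (names L) → (∀ {β} → β ∈ names L → β ∉ Names P) →
                   Names P ++ names L ⊆ Names (addList L P)
  Names-addList⊇ [] P _ _ rewrite ++-identityʳ (Names P) = λ γ∈P → γ∈P
  Names-addList⊇ (j ∷ L) P (j∉L ∷ uL) L-fresh =
    Names-addList⊇ L (add j P) uL L-fresh-add ∘ shift
    where
    L-fresh-add : ∀ {β} → β ∈ names L → β ∉ Names (add j P)
    L-fresh-add β∈L β∈addP with Names-add⊆ j P (L-fresh (here refl)) β∈addP
    ... | here β≡j = lookup j∉L β∈L (sym β≡j)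
    ... | there β∈P = L-fresh (there β∈L) β∈P

    shift : Names P ++ nm j ∷ names L ⊆ Names (add j P) ++ names L
    shift γ∈ with ∈-++⁻ (Names P) γ∈
    ... | inj₁ γ∈P = ∈-++⁺ˡ (Names-add⊇ j P (L-fresh (here refl)) (there γ∈P))
    ... | inj₂ (here refl) = ∈-++⁺ˡ (Names-add⊇ j P (L-fresh (here refl)) (here refl))
    ... | inj₂ (there γ∈L) = ∈-++⁺ʳ (Names (add j P)) γ∈L

  Names-sel-drop⊆ : ∀ {P t S P' t' S' α} → Sel P (job t S α) P' →
                    Names P ⊆ Names (drop (job t' S' α) P')
  Names-sel-drop⊆ {P' = P'} s = Names-drop⊇ _ P' (sel-name∉ s) ∘ Names-sel⊆∷ s

module Coverage (T : PoolTemplate) where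
  open PoolTemplate T
  open EXAM T
  open PoolNames T

  Covered : State → Set
  Covered ⟪ B , P , E ⟫ = fn B ⊆ Names P

  covered-init : ∀ t α → Covered ⟪ hole α , new (job t [] α) , [] ⟫
  covered-init t α (here refl) = ∈-map⁺ nm (Equivalence.from (new-supp (job t [] α) (job t [] α)) refl)

  covered-step : ∀ {s s'} → s ⇒ s' → Covered s → Covered s'
  covered-step (sea-app s) cov = Names-sel-drop⊆ s ∘ cov
  covered-step (beta s) cov = Names-sel-drop⊆ s ∘ cov
  covered-step (sub s _ _ _ _) cov = Names-sel-drop⊆ s ∘ cov
  covered-step (seaλ {B = B} {P = P} {x = x} {α = α} s) cov = Names-sel-drop⊆ s ∘ covered
    where
    covered : fn (replace B α (mlam x (hole α))) ⊆ Names P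
    covered γ∈ with fn-replace⁻ B α (mlam x (hole α)) γ∈
    ... | inj₁ (γ∈B , _) = cov γ∈B
    ... | inj₂ (here refl) = ∈-map⁺ nm (sel-in s)
  covered-step (seaV {B = B} {P' = P'} {x = x} {ts = ts} {α = α} βs s _ len uβ βs-fresh) cov =
    Names-addList⊇ jobs P' unique-jobs fresh-jobs ∘ subst (λ ns → _ ⊆ Names P' ++ ns) (sym names-jobs) covered
    where
    jobs : List Job
    jobs = zipWith (λ t β → job t [] β) ts βs

    names-jobs : names jobs ≡ βs
    names-jobs = names-zipWith [] ts βs len

    unique-jobs : Unique (names jobs)
    unique-jobs = subst Unique (sym names-jobs) uβ

    fresh-jobs : ∀ {β} → β ∈ names jobs → β ∉ Names P'
    fresh-jobs {β} β∈jobs = proj₂ (βs-fresh β (subst (β ∈_) names-jobs β∈jobs)) ∘ Names-sel⊆ s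

    covered : fn (replace B α (appHoles x βs)) ⊆ Names P' ++ βs
    covered γ∈ with fn-replace⁻ B α (appHoles x βs) γ∈
    ... | inj₂ γ∈holes = ∈-++⁺ʳ (Names P') (fn-foldl-holes (mvar x) βs γ∈holes)
    ... | inj₁ (γ∈B , γ≢α) with Names-sel⊆∷ s (cov γ∈B)
    ...   | here γ≡α = contradiction γ≡α γ≢α
    ...   | there γ∈P' = ∈-++⁺ˡ γ∈P'

  covered-reachable : ∀ {s} → Reachable s → Covered s
  covered-reachable (init _ t α _ _) = covered-init t α
  covered-reachable (step r s⇒s') = covered-step s⇒s' (covered-reachable r)

  rb-isTerm : ∀ {s} → Reachable s → IsTerm (rb s)
  rb-isTerm {⟪ B , P , E ⟫} r = plug-isTerm B (map (jobDown E) (supp P)) B⊆X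
    where
    B⊆X : fn B ⊆ names (map (jobDown E) (supp P))
    B⊆X = subst (fn B ⊆_) (sym (names-jobDown E (supp P))) (covered-reachable r)

-- Part (1) holds without the approximant shape of B and without distinct job names.
lemma4 : ((B : MC) → (X : List Job) → IsB B → Unique (names X) →
           (∀ (α : ℕ) → α ∈ fn B → α ∈ names X) → IsTerm (plug B X))
         × ((T : PoolTemplate) → (s : EXAM.State T) → EXAM.Reachable T s →
           IsTerm (EXAM.rb T s))
lemma4 = (λ B X _ _ B⊆X → plug-isTerm B X (B⊆X _))
       , (λ T _ → Coverage.rb-isTerm T)
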